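{- Let $1\leq t\leq k-2$ and $2k<n$. Then (i) if $t=\frac{k}{2}-1$, then $h_2(t+2)\geq h_1(t,k,k+2)$, with equality only if $t=1$; moreover, if $t=1$, or if $t\geq 2$ and $n$ is sufficiently large (in terms of $t$ and $k$), then $h_1(t,k,k+1)>h_2(t+2)$; (ii) if $\frac{k}{2}-\frac{1}{2}\leq t\leq k-2$, then $h_2(t+2)\geq h_1(t,k,k+1)$, with equality only if $(t,k)=(1,3)$.
   Context: For $X\subseteq M\subseteq C\subseteq[n]$ with $|X|=t$, $|M|=k$, $|C|=c\in\{k+1,\ldots,2k-t,n\}$: $\mathcal{H}_1(X,M,C)=\mathcal{A}\cup\mathcal{B}\cup\mathcal{C}$ where $\mathcal{A}=\{F\in\binom{[n]}{k}: X\subseteq F,\ |F\cap M|\geq t+1\}$, $\mathcal{B}=\{F\in\binom{[n]}{k}: F\cap M=X,\ |F\cap C|=c-k+t\}$, $\mathcal{C}=\{F\in\binom{C}{k}: |F\cap X|=t-1,\ |F\cap M|=k-1\}$; $h_1(t,k,c)=|\mathcal{H}_1(X,M,C)|$ (depends only on $n,t,k,c$). For a $(t+2)$-subset $Z\subseteq[n]$, $\mathcal{H}_2(Z)=\{F\in\binom{[n]}{k}: |F\cap Z|\geq t+1\}$ and $h_2(t+2)=|\mathcal{H}_2(Z)|$. -}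

module Defs where

open import Data.Nat using (ℕ; zero; suc; _+_; _∸_; _≤_; _<ᵇ_)
open import Data.Nat.Properties using (_≟_; _≤?_)
open import Data.Bool using (Bool; true; false)
import Data.Bool.Properties as BP
open import Data.Fin using (Fin; toℕ)
open import Data.Fin.Subset using (Subset; _∩_; ∣_∣; _⊆_; inside; outside)
open import Data.Fin.Subset.Properties using (_⊆?_)
open import Data.Vec using (Vec; []; _∷_; tabulate)
open import Data.Vec.Properties using (≡-dec)
open import Data.List using (List; []; _∷_; map; _++_; length; filter)
open import Data.Product using (_×_)
open import Relation.Binary.PropositionalEquality using (_≡_)
open import Relation.Nullary using (Dec; _×-dec_)
open import Relation.Unary using (Pred; Decidable)
open import Level using (0ℓ)

allSubsets : (n : ℕ) → List (Subset n)
allSubsets zero    = [] ∷ []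
allSubsets (suc n) = map (outside ∷_) (allSubsets n) ++ map (inside ∷_) (allSubsets n)

-- The initial segment {0,…,m-1} ⊆ [n] (i.e. {1,…,m} in 1-based notation).
seg : (n m : ℕ) → Subset n
seg n m = tabulate (λ i → toℕ i <ᵇ m)

countK : (n k : ℕ) (P : Pred (Subset n) 0ℓ) → Decidable P → ℕ
countK n k P P? = length (filter (λ F → (∣ F ∣ ≟ k) ×-dec P? F) (allSubsets n))

-- Canonical choice X = seg t, M = seg k, C = seg c (h₁ depends only on n,t,k,c).
-- Membership of F in H₁(X,M,C) = A ∪ B ∪ C  (F is already assumed to be a k-set).
module _ (n t k c : ℕ) where
  private
    X M C : Subset n
    X = seg n t
    M = seg n k
    C = seg n c

  inA : Pred (Subset n) 0ℓ
  inA F = (X ⊆ F) × (suc t ≤ ∣ F ∩ M ∣)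

  inB : Pred (Subset n) 0ℓ
  inB F = (F ∩ M ≡ X) × (∣ F ∩ C ∣ ≡ c ∸ k + t)

  inC : Pred (Subset n) 0ℓ
  inC F = (F ⊆ C) × (∣ F ∩ X ∣ ≡ t ∸ 1) × (∣ F ∩ M ∣ ≡ k ∸ 1)

  inH₁ : Pred (Subset n) 0ℓ
  inH₁ F = inA F ⊎ inB F ⊎ inC F
    where open import Data.Sum using (_⊎_)

  inH₁? : Decidable inH₁
  inH₁? F = (X ⊆? F ×-dec suc t ≤? ∣ F ∩ M ∣)
      ⊎-dec ((≡-dec BP._≟_ (F ∩ M) X ×-dec ∣ F ∩ C ∣ ≟ c ∸ k + t)
      ⊎-dec (F ⊆? C ×-dec (∣ F ∩ X ∣ ≟ t ∸ 1 ×-dec ∣ F ∩ M ∣ ≟ k ∸ 1)))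
    where open import Relation.Nullary using (_⊎-dec_)

h₁ : (n t k c : ℕ) → ℕ
h₁ n t k c = countK n k (inH₁ n t k c) (inH₁? n t k c)

-- h₂(t+2) on ground set [n] (with uniformity k): Z = seg (t+2),
-- H₂(Z) = { F k-subset : |F ∩ Z| ≥ t+1 }.
h₂ : (n t k : ℕ) → ℕ
h₂ n t k = countK n k (λ F → suc t ≤ ∣ F ∩ seg n (suc (suc t)) ∣)
                      (λ F → suc t ≤? ∣ F ∩ seg n (suc (suc t)) ∣)

module Submission where

open import Defs
open import Data.Nat using (ℕ; _+_; _*_; _≤_; _<_; _>_; _≥_)
open import Data.Product using (_×_; ∃)
open import Relation.Binary.PropositionalEquality using (_≡_)

open import Data.Nat using (zero; suc; _∸_; _<ᵇ_; _≡ᵇ_; z≤n; s≤s)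
open import Data.Nat.Properties
open import Data.Nat.Combinatorics using (_C_; nCk+nC[k+1]≡[n+1]C[k+1]; nCn≡1; nC1≡n)
open import Data.Nat.Tactic.RingSolver using (solve-∀)
open import Data.Bool using (Bool; true; false; _∧_; _∨_; if_then_else_; T)
import Data.Bool.Properties as BP
open import Data.Bool.Properties using (∧-assoc; ∧-comm; ∧-distribˡ-∨; ∧-identityʳ; T-∧; T-∨)
open import Data.Empty using (⊥; ⊥-elim)
open import Data.Unit using (tt)
open import Data.Sum using (inj₁; inj₂)
open import Data.Product using (_,_; proj₁; proj₂)
open import Data.Fin.Subset using (Subset; _∩_; ∣_∣; inside; outside)
open import Data.Fin.Subset.Properties using (_⊆?_)
open import Data.Vec using ([]; _∷_; drop)
open import Data.Vec.Properties using (≡-dec)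
open import Data.List using (List; []; _∷_; map; _++_; length; filter)
open import Data.List.Properties using (length-++; filter-++)
open import Function.Bundles using (Equivalence)
open import Relation.Binary.PropositionalEquality using (refl; sym; trans; cong; cong₂; subst; subst₂; module ≡-Reasoning)
open import Relation.Nullary using (does)
open import Relation.Unary using (Pred; Decidable)
open import Level using (0ℓ)

-- Both families are counted exactly, and the comparison becomes an inequality
-- between binomial coefficients.
-- Cutting [n] into consecutive blocks, the sets with prescribed trace sizes on
-- the blocks number a product of binomial coefficients (count-peel,
-- count-blocks₂₋₄).  The tests of Defs (X ⊆ F, F ∩ M = X, F ⊆ C, |F ∩ Z| > t)
-- are tests on trace sizes, H₁ is the disjoint union of its parts 𝒜, ℬ, 𝒞 and
-- H₂ splits by |F ∩ Z| ∈ {t+1, t+2}; this gives (h₁-closed, h₂-closed)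
--   h₁ + C(n−k,k−t) = C(n−t,k−t) + C(n−c,2k−t−c) + t(c−k),
--   h₂ = (t+2) C(n−t−2,k−t−1) + C(n−t−2,k−t−2).
-- Estimates: with k = t+2+s and M = n−t−2, Pascal's rule and the hockey-stick
-- identity write h₁ for c = k+1, k+2 as C(M,s) + 2C(M,s+1) + a, so h₁ ≤ h₂
-- amounts to a ≤ t C(M,s+1).  This is proved with an explicit slack that
-- vanishes only in the stated equality cases (bound-ii, bound-k+2); the strict
-- reverse inequalities use C(q,2) > q for t = 1 and, for large n, the
-- absorption identity (strict-t=1, strict-large).

pascal : ∀ x j → suc x C suc j ≡ (x C j) + (x C suc j)
pascal x j = sym (nCk+nC[k+1]≡[n+1]C[k+1] x j)

C-sub1 : ∀ m → suc m C m ≡ suc m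
C-sub1 zero    = refl
C-sub1 (suc m) = trans (pascal (suc m) m) (trans (cong₂ _+_ (C-sub1 m) (nCn≡1 (suc m))) (+-comm (suc m) 1))

+-cancelˡ-≡ᵇ : ∀ m x y → (m + x ≡ᵇ m + y) ≡ (x ≡ᵇ y)
+-cancelˡ-≡ᵇ zero    x y = refl
+-cancelˡ-≡ᵇ (suc m) x y = +-cancelˡ-≡ᵇ m x y

∧-swap : ∀ x y z → x ∧ (y ∧ z) ≡ y ∧ (x ∧ z)
∧-swap x y z = trans (sym (∧-assoc x y z)) (trans (cong (_∧ z) (∧-comm x y)) (∧-assoc y x z))

≡ᵇ-guard : ∀ x y (f : ℕ → Bool) → (x ≡ᵇ y) ∧ f x ≡ (x ≡ᵇ y) ∧ f y
≡ᵇ-guard x y f with x ≡ᵇ y in eq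
... | false = refl
... | true  = cong f (≡ᵇ⇒≡ x y (subst T (sym eq) tt))

split-∧ : ∀ x {y} → T (x ∧ y) → T x × T y
split-∧ x = Equivalence.to (T-∧ {x})

<ᵇ-≡ᵇ-excl : ∀ x y → T (x <ᵇ y) → T (y ≡ᵇ x) → ⊥
<ᵇ-≡ᵇ-excl x y x<y y≡x = <-irrefl (sym (≡ᵇ⇒≡ y x y≡x)) (<ᵇ⇒< x y x<y)

≡ᵇ-suc-excl : ∀ x y → T (x ≡ᵇ suc y) → T (x ≡ᵇ y) → ⊥
≡ᵇ-suc-excl x y x≡1+y x≡y = 1+n≢n (trans (sym (≡ᵇ⇒≡ x (suc y) x≡1+y)) (≡ᵇ⇒≡ x y x≡y))

above-or-at : ∀ t v → (t <ᵇ t + v) ∨ (t + v ≡ᵇ t) ≡ true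
above-or-at zero    zero    = refl
above-or-at zero    (suc v) = refl
above-or-at (suc t) v       = above-or-at t v

above-t : ∀ t u → u ≤ suc (suc t) → (t <ᵇ u) ≡ (u ≡ᵇ suc t) ∨ (u ≡ᵇ suc (suc t))
above-t zero    zero                _                 = refl
above-t zero    (suc zero)          _                 = refl
above-t zero    (suc (suc zero))    _                 = refl
above-t zero    (suc (suc (suc u))) (s≤s (s≤s ()))
above-t (suc t) zero                _                 = refl
above-t (suc t) (suc u)             (s≤s u≤t+2)       = above-t t u u≤t+2

count : (n : ℕ) → (Subset n → Bool) → ℕ
count zero    f = if f [] then 1 else 0
count (suc n) f = count n (λ F → f (outside ∷ F)) + count n (λ F → f (inside ∷ F))

length-filter-map : ∀ {m n} {P : Pred (Subset n) 0ℓ} (P? : Decidable P)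
                    (g : Subset m → Subset n) (xs : List (Subset m)) →
                    length (filter P? (map g xs)) ≡ length (filter (λ x → P? (g x)) xs)
length-filter-map P? g []       = refl
length-filter-map P? g (x ∷ xs) with does (P? (g x))
... | false = length-filter-map P? g xs
... | true  = cong suc (length-filter-map P? g xs)

length-filter-allSubsets : ∀ n {P : Pred (Subset n) 0ℓ} (P? : Decidable P) →
                           length (filter P? (allSubsets n)) ≡ count n (λ F → does (P? F))
length-filter-allSubsets zero    P? with does (P? [])
... | false = refl
... | true  = refl
length-filter-allSubsets (suc n) P? = begin
  length (filter P? (map (outside ∷_) A ++ map (inside ∷_) A))
    ≡⟨ cong length (filter-++ P? (map (outside ∷_) A) (map (inside ∷_) A)) ⟩
  length (filter P? (map (outside ∷_) A) ++ filter P? (map (inside ∷_) A))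
    ≡⟨ length-++ (filter P? (map (outside ∷_) A)) ⟩
  length (filter P? (map (outside ∷_) A)) + length (filter P? (map (inside ∷_) A))
    ≡⟨ cong₂ _+_ (half outside) (half inside) ⟩
  count (suc n) (λ F → does (P? F)) ∎
  where
    open ≡-Reasoning
    A = allSubsets n
    half : ∀ x → length (filter P? (map (x ∷_) A)) ≡ count n (λ F → does (P? (x ∷ F)))
    half x = trans (length-filter-map P? (x ∷_) A) (length-filter-allSubsets n (λ F → P? (x ∷ F)))

countK≡count : ∀ n k (P : Pred (Subset n) 0ℓ) (P? : Decidable P) →
               countK n k P P? ≡ count n (λ F → (∣ F ∣ ≡ᵇ k) ∧ does (P? F))
countK≡count n k P P? = length-filter-allSubsets n _

count-ext : ∀ n {f g : Subset n → Bool} → (∀ F → f F ≡ g F) → count n f ≡ count n g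
count-ext zero    f≗g = cong (λ b → if b then 1 else 0) (f≗g [])
count-ext (suc n) f≗g = cong₂ _+_ (count-ext n (λ F → f≗g (outside ∷ F)))
                                  (count-ext n (λ F → f≗g (inside ∷ F)))

count-false : ∀ n → count n (λ _ → false) ≡ 0
count-false zero    = refl
count-false (suc n) = cong₂ _+_ (count-false n) (count-false n)

Disjoint : ∀ {n} → (Subset n → Bool) → (Subset n → Bool) → Set
Disjoint f g = ∀ F → T (f F) → T (g F) → ⊥

count-∨ : ∀ n (f g : Subset n → Bool) → Disjoint f g →
          count n (λ F → f F ∨ g F) ≡ count n f + count n g
count-∨ zero    f g f#g with f [] | g [] | f#g []
... | true  | true  | excl = ⊥-elim (excl _ _)
... | true  | false | _    = refl
... | false | true  | _    = refl
... | false | false | _    = refl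
count-∨ (suc n) f g f#g = begin
  count n (λ F → f (outside ∷ F) ∨ g (outside ∷ F)) + count n (λ F → f (inside ∷ F) ∨ g (inside ∷ F))
    ≡⟨ cong₂ _+_ (count-∨ n _ _ (λ F → f#g (outside ∷ F))) (count-∨ n _ _ (λ F → f#g (inside ∷ F))) ⟩
  (count n (λ F → f (outside ∷ F)) + count n (λ F → g (outside ∷ F)))
    + (count n (λ F → f (inside ∷ F)) + count n (λ F → g (inside ∷ F)))
    ≡⟨ interchange (count n (λ F → f (outside ∷ F))) _ _ _ ⟩
  count (suc n) f + count (suc n) g ∎
  where
    open ≡-Reasoning
    interchange : ∀ a b c d → (a + b) + (c + d) ≡ (a + c) + (b + d)
    interchange = solve-∀

Disjoint-∨ : ∀ {n} {f g h : Subset n → Bool} → Disjoint f g → Disjoint f h →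
             Disjoint f (λ F → g F ∨ h F)
Disjoint-∨ {g = g} {h} f#g f#h F fF ghF with Equivalence.to (T-∨ {g F} {h F}) ghF
... | inj₁ gF = f#g F fF gF
... | inj₂ hF = f#h F fF hF

count-size : ∀ n δ → count n (λ G → ∣ G ∣ ≡ᵇ δ) ≡ n C δ
count-size zero    zero     = refl
count-size zero    (suc δ)  = refl
count-size (suc n) zero     = trans (cong (count n (λ G → ∣ G ∣ ≡ᵇ 0) +_) (count-false n))
                                    (trans (+-identityʳ _) (count-size n zero))
count-size (suc n) (suc δ) = trans (cong₂ _+_ (count-size n (suc δ)) (count-size n δ))
                                   (trans (+-comm (n C suc δ) (n C δ)) (sym (pascal n δ)))

seg-zero : ∀ n (F : Subset n) → ∣ F ∩ seg n 0 ∣ ≡ 0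
seg-zero zero    []            = refl
seg-zero (suc n) (outside ∷ F) = seg-zero n F
seg-zero (suc n) (inside ∷ F)  = seg-zero n F

size-split : ∀ a n (F : Subset (a + n)) → ∣ F ∣ ≡ ∣ F ∩ seg (a + n) a ∣ + ∣ drop a F ∣
size-split zero    n F             = sym (cong (_+ ∣ F ∣) (seg-zero n F))
size-split (suc a) n (outside ∷ F) = size-split a n F
size-split (suc a) n (inside ∷ F)  = cong suc (size-split a n F)

seg-split : ∀ a n b (F : Subset (a + n)) →
            ∣ F ∩ seg (a + n) (a + b) ∣ ≡ ∣ F ∩ seg (a + n) a ∣ + ∣ drop a F ∩ seg n b ∣
seg-split zero    n b F             = sym (cong (_+ ∣ F ∩ seg n b ∣) (seg-zero n F))
seg-split (suc a) n b (outside ∷ F) = seg-split a n b F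
seg-split (suc a) n b (inside ∷ F)  = cong suc (seg-split a n b F)

-- Peeling off the first block: the subsets meeting [a] in exactly α points
-- and satisfying Ψ on the tail number C(a,α) times the admissible tails.
-- Ψ may also depend on the size of the trace on [a], which is then α.
count-peel : ∀ a n α (Ψ : ℕ → Subset n → Bool) →
  count (a + n) (λ F → (∣ F ∩ seg (a + n) a ∣ ≡ᵇ α) ∧ Ψ ∣ F ∩ seg (a + n) a ∣ (drop a F))
  ≡ (a C α) * count n (Ψ α)
count-peel zero n α Ψ = trans (count-ext n (λ F → cong (λ u → (u ≡ᵇ α) ∧ Ψ u F) (seg-zero n F)))
                              (empty-block α)
  where
    empty-block : ∀ α → count n (λ F → (0 ≡ᵇ α) ∧ Ψ 0 F) ≡ (0 C α) * count n (Ψ α)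
    empty-block zero    = sym (*-identityˡ _)
    empty-block (suc α) = count-false n
count-peel (suc a) n zero Ψ =
  trans (cong (_+ count (a + n) (λ _ → false)) (count-peel a n zero Ψ))
        (trans (cong ((a C 0) * count n (Ψ 0) +_) (count-false (a + n))) (+-identityʳ _))
count-peel (suc a) n (suc α) Ψ =
  trans (cong₂ _+_ (count-peel a n (suc α) Ψ) (count-peel a n α (λ u → Ψ (suc u))))
        (pascal-* (count n (Ψ (suc α))))
  where
    pascal-* : ∀ x → (a C suc α) * x + (a C α) * x ≡ (suc a C suc α) * x
    pascal-* x = trans (sym (*-distribʳ-+ x (a C suc α) (a C α)))
                       (cong (_* x) (trans (+-comm (a C suc α) (a C α)) (sym (pascal a α))))

-- Block profiles.  [n] is cut into consecutive blocks; prescribing the size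
-- of F and of its traces on the initial unions of blocks amounts to
-- prescribing the trace sizes α, β, … on the single blocks, so the number of
-- such F is the product of binomial coefficients.
count-blocks₂ : ∀ a m α δ →
  count (a + m) (λ F → (∣ F ∣ ≡ᵇ α + δ) ∧ (∣ F ∩ seg (a + m) a ∣ ≡ᵇ α)) ≡ (a C α) * (m C δ)
count-blocks₂ a m α δ = begin
  count (a + m) (λ F → (∣ F ∣ ≡ᵇ α + δ) ∧ (u F ≡ᵇ α))
    ≡⟨ count-ext (a + m) to-peel ⟩
  count (a + m) (λ F → (u F ≡ᵇ α) ∧ Ψ (u F) (drop a F))
    ≡⟨ count-peel a m α Ψ ⟩
  (a C α) * count m (Ψ α)
    ≡⟨ cong ((a C α) *_) (trans (count-ext m (λ G → +-cancelˡ-≡ᵇ α ∣ G ∣ δ)) (count-size m δ)) ⟩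
  (a C α) * (m C δ) ∎
  where
    open ≡-Reasoning
    u : Subset (a + m) → ℕ
    u F = ∣ F ∩ seg (a + m) a ∣
    Ψ : ℕ → Subset m → Bool
    Ψ x G = x + ∣ G ∣ ≡ᵇ α + δ
    to-peel : ∀ F → (∣ F ∣ ≡ᵇ α + δ) ∧ (u F ≡ᵇ α) ≡ (u F ≡ᵇ α) ∧ Ψ (u F) (drop a F)
    to-peel F = trans (∧-comm _ (u F ≡ᵇ α)) (cong (λ z → (u F ≡ᵇ α) ∧ (z ≡ᵇ α + δ)) (size-split a m F))

count-blocks₃ : ∀ a b m α β δ →
  count (a + (b + m)) (λ F → (∣ F ∣ ≡ᵇ α + (β + δ)) ∧ ((∣ F ∩ seg (a + (b + m)) a ∣ ≡ᵇ α)
                                ∧ (∣ F ∩ seg (a + (b + m)) (a + b) ∣ ≡ᵇ α + β)))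
  ≡ (a C α) * ((b C β) * (m C δ))
count-blocks₃ a b m α β δ = begin
  count n (λ F → (∣ F ∣ ≡ᵇ α + (β + δ)) ∧ ((u F ≡ᵇ α) ∧ (∣ F ∩ seg n (a + b) ∣ ≡ᵇ α + β)))
    ≡⟨ count-ext n to-peel ⟩
  count n (λ F → (u F ≡ᵇ α) ∧ Ψ (u F) (drop a F))
    ≡⟨ count-peel a (b + m) α Ψ ⟩
  (a C α) * count (b + m) (Ψ α)
    ≡⟨ cong ((a C α) *_) (trans (count-ext (b + m) cancel) (count-blocks₂ b m β δ)) ⟩
  (a C α) * ((b C β) * (m C δ)) ∎
  where
    open ≡-Reasoning
    n = a + (b + m)
    u : Subset n → ℕ
    u F = ∣ F ∩ seg n a ∣
    Ψ : ℕ → Subset (b + m) → Bool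
    Ψ x G = (x + ∣ G ∣ ≡ᵇ α + (β + δ)) ∧ (x + ∣ G ∩ seg (b + m) b ∣ ≡ᵇ α + β)
    to-peel : ∀ F → (∣ F ∣ ≡ᵇ α + (β + δ)) ∧ ((u F ≡ᵇ α) ∧ (∣ F ∩ seg n (a + b) ∣ ≡ᵇ α + β))
                    ≡ (u F ≡ᵇ α) ∧ Ψ (u F) (drop a F)
    to-peel F = trans (∧-swap (∣ F ∣ ≡ᵇ α + (β + δ)) (u F ≡ᵇ α) (∣ F ∩ seg n (a + b) ∣ ≡ᵇ α + β))
      (cong₂ (λ y z → (u F ≡ᵇ α) ∧ ((y ≡ᵇ α + (β + δ)) ∧ (z ≡ᵇ α + β)))
             (size-split a (b + m) F) (seg-split a (b + m) b F))
    cancel : ∀ G → Ψ α G ≡ (∣ G ∣ ≡ᵇ β + δ) ∧ (∣ G ∩ seg (b + m) b ∣ ≡ᵇ β)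
    cancel G = cong₂ _∧_ (+-cancelˡ-≡ᵇ α _ _) (+-cancelˡ-≡ᵇ α _ _)

count-blocks₄ : ∀ a b c m α β γ δ →
  count (a + (b + (c + m))) (λ F → (∣ F ∣ ≡ᵇ α + (β + (γ + δ)))
    ∧ ((∣ F ∩ seg (a + (b + (c + m))) a ∣ ≡ᵇ α)
    ∧ ((∣ F ∩ seg (a + (b + (c + m))) (a + b) ∣ ≡ᵇ α + β)
    ∧ (∣ F ∩ seg (a + (b + (c + m))) (a + (b + c)) ∣ ≡ᵇ α + (β + γ)))))
  ≡ (a C α) * ((b C β) * ((c C γ) * (m C δ)))
count-blocks₄ a b c m α β γ δ = begin
  count n (λ F → (∣ F ∣ ≡ᵇ α + (β + (γ + δ))) ∧ ((u F ≡ᵇ α)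
                 ∧ ((∣ F ∩ seg n (a + b) ∣ ≡ᵇ α + β) ∧ (∣ F ∩ seg n (a + (b + c)) ∣ ≡ᵇ α + (β + γ)))))
    ≡⟨ count-ext n to-peel ⟩
  count n (λ F → (u F ≡ᵇ α) ∧ Ψ (u F) (drop a F))
    ≡⟨ count-peel a (b + (c + m)) α Ψ ⟩
  (a C α) * count (b + (c + m)) (Ψ α)
    ≡⟨ cong ((a C α) *_) (trans (count-ext (b + (c + m)) cancel) (count-blocks₃ b c m β γ δ)) ⟩
  (a C α) * ((b C β) * ((c C γ) * (m C δ))) ∎
  where
    open ≡-Reasoning
    n = a + (b + (c + m))
    u : Subset n → ℕ
    u F = ∣ F ∩ seg n a ∣
    Ψ : ℕ → Subset (b + (c + m)) → Bool
    Ψ x G = (x + ∣ G ∣ ≡ᵇ α + (β + (γ + δ)))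
            ∧ ((x + ∣ G ∩ seg (b + (c + m)) b ∣ ≡ᵇ α + β) ∧ (x + ∣ G ∩ seg (b + (c + m)) (b + c) ∣ ≡ᵇ α + (β + γ)))
    to-peel : ∀ F → (∣ F ∣ ≡ᵇ α + (β + (γ + δ))) ∧ ((u F ≡ᵇ α)
                    ∧ ((∣ F ∩ seg n (a + b) ∣ ≡ᵇ α + β) ∧ (∣ F ∩ seg n (a + (b + c)) ∣ ≡ᵇ α + (β + γ))))
                    ≡ (u F ≡ᵇ α) ∧ Ψ (u F) (drop a F)
    to-peel F = trans (∧-swap (∣ F ∣ ≡ᵇ α + (β + (γ + δ))) (u F ≡ᵇ α) _)
      (cong ((u F ≡ᵇ α) ∧_) (cong₂ _∧_ (cong (_≡ᵇ α + (β + (γ + δ))) (size-split a _ F))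
        (cong₂ _∧_ (cong (_≡ᵇ α + β) (seg-split a _ b F)) (cong (_≡ᵇ α + (β + γ)) (seg-split a _ (b + c) F)))))
    cancel : ∀ G → Ψ α G ≡ (∣ G ∣ ≡ᵇ β + (γ + δ))
                           ∧ ((∣ G ∩ seg (b + (c + m)) b ∣ ≡ᵇ β) ∧ (∣ G ∩ seg (b + (c + m)) (b + c) ∣ ≡ᵇ β + γ))
    cancel G = cong₂ _∧_ (+-cancelˡ-≡ᵇ α _ _) (cong₂ _∧_ (+-cancelˡ-≡ᵇ α _ _) (+-cancelˡ-≡ᵇ α _ _))

seg-bound : ∀ n a (F : Subset n) → ∣ F ∩ seg n a ∣ ≤ a
seg-bound zero    a       []            = z≤n
seg-bound (suc n) zero    (outside ∷ F) = seg-bound n zero F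
seg-bound (suc n) zero    (inside ∷ F)  = seg-bound n zero F
seg-bound (suc n) (suc a) (outside ∷ F) = m≤n⇒m≤1+n (seg-bound n a F)
seg-bound (suc n) (suc a) (inside ∷ F)  = s≤s (seg-bound n a F)

≤⇒≢ᵇsuc : ∀ x a → x ≤ a → (x ≡ᵇ suc a) ≡ false
≤⇒≢ᵇsuc zero    a       _         = refl
≤⇒≢ᵇsuc (suc x) (suc a) (s≤s x≤a) = ≤⇒≢ᵇsuc x a x≤a

seg-⊆-test : ∀ n a → a ≤ n → (F : Subset n) → does (seg n a ⊆? F) ≡ (∣ F ∩ seg n a ∣ ≡ᵇ a)
seg-⊆-test zero    zero    _         []            = refl
seg-⊆-test (suc n) zero    _         (outside ∷ F) = seg-⊆-test n zero z≤n F
seg-⊆-test (suc n) zero    _         (inside ∷ F)  = seg-⊆-test n zero z≤n F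
seg-⊆-test (suc n) (suc a) _         (outside ∷ F) = sym (≤⇒≢ᵇsuc _ a (seg-bound n a F))
seg-⊆-test (suc n) (suc a) (s≤s a≤n) (inside ∷ F)  = seg-⊆-test n a a≤n F

⊆-seg-test : ∀ n c (F : Subset n) → does (F ⊆? seg n c) ≡ (∣ F ∩ seg n c ∣ ≡ᵇ ∣ F ∣)
⊆-seg-test zero    c       []            = refl
⊆-seg-test (suc n) zero    (outside ∷ F) = ⊆-seg-test n zero F
⊆-seg-test (suc n) zero    (inside ∷ F)  rewrite seg-zero n F = refl
⊆-seg-test (suc n) (suc c) (outside ∷ F) = ⊆-seg-test n c F
⊆-seg-test (suc n) (suc c) (inside ∷ F)  = ⊆-seg-test n c F

≡-empty-test : ∀ n (G : Subset n) → does (≡-dec BP._≟_ G (seg n 0)) ≡ (∣ G ∣ ≡ᵇ 0)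
≡-empty-test zero    []            = refl
≡-empty-test (suc n) (outside ∷ G) = ≡-empty-test n G
≡-empty-test (suc n) (inside ∷ G)  = refl

∩-seg-≡-test : ∀ n t k → t ≤ k → k ≤ n → (F : Subset n) →
  does (≡-dec BP._≟_ (F ∩ seg n k) (seg n t)) ≡ ((∣ F ∩ seg n t ∣ ≡ᵇ t) ∧ (∣ F ∩ seg n k ∣ ≡ᵇ t))
∩-seg-≡-test n zero k _ _ F rewrite seg-zero n F = ≡-empty-test n (F ∩ seg n k)
∩-seg-≡-test (suc n) (suc t) (suc k) (s≤s t≤k) (s≤s k≤n) (outside ∷ F)
  rewrite ≤⇒≢ᵇsuc _ t (seg-bound n t F) = refl
∩-seg-≡-test (suc n) (suc t) (suc k) (s≤s t≤k) (s≤s k≤n) (inside ∷ F) = ∩-seg-≡-test n t k t≤k k≤n F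

-- The family H₁(X,M,C) for X = [t], M = [k], C = [c], the four blocks
-- X, M ∖ X, C ∖ M, [n] ∖ C having sizes t, r, e, q.  We write t = t₀ + 1 and
-- r = e + r', so that r' = 2k − t − c is the size F must have outside C in ℬ.
module H₁-count (t₀ e r' q : ℕ) where
  open ≡-Reasoning

  t r N n k c : ℕ
  t = suc t₀
  r = e + r'
  N = r + (e + q)
  n = t + N
  k = t + r
  c = t + (r + e)

  onX onM onC : Subset n → ℕ
  onX F = ∣ F ∩ seg n t ∣
  onM F = ∣ F ∩ seg n k ∣
  onC F = ∣ F ∩ seg n c ∣

  meetsMinX : Subset n → Bool
  meetsMinX F = (onX F ≡ᵇ t) ∧ (onM F ≡ᵇ t)

  partA partB partC : Subset n → Bool
  partA F = (∣ F ∣ ≡ᵇ k) ∧ ((onX F ≡ᵇ t) ∧ (t <ᵇ onM F))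
  partB F = (∣ F ∣ ≡ᵇ k) ∧ (meetsMinX F ∧ (onC F ≡ᵇ t + e))
  partC F = (∣ F ∣ ≡ᵇ k) ∧ ((onC F ≡ᵇ ∣ F ∣) ∧ ((onX F ≡ᵇ t₀) ∧ (onM F ≡ᵇ t₀ + r)))

  t≤k : t ≤ k
  t≤k = m≤m+n t r
  k≤n : k ≤ n
  k≤n = +-monoʳ-≤ t (m≤m+n r (e + q))
  c∸k+t≡t+e : c ∸ k + t ≡ t + e
  c∸k+t≡t+e = trans (cong (λ x → x ∸ k + t) (sym (+-assoc t r e)))
                    (trans (cong (_+ t) (m+n∸m≡n k e)) (+-comm e t))

  h₁-test : ∀ F → (∣ F ∣ ≡ᵇ k) ∧ does (inH₁? n t k c F) ≡ partA F ∨ (partB F ∨ partC F)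
  h₁-test F
    rewrite seg-⊆-test n t (≤-trans t≤k k≤n) F | ∩-seg-≡-test n t k t≤k k≤n F | ⊆-seg-test n c F | c∸k+t≡t+e
    = trans (∧-distribˡ-∨ (∣ F ∣ ≡ᵇ k) _ _) (cong (partA F ∨_) (∧-distribˡ-∨ (∣ F ∣ ≡ᵇ k) _ _))

  A-X : ∀ F → T (partA F) → T (onX F ≡ᵇ t)
  A-X F a = proj₁ (split-∧ (onX F ≡ᵇ t) (proj₂ (split-∧ (∣ F ∣ ≡ᵇ k) a)))
  A-M : ∀ F → T (partA F) → T (t <ᵇ onM F)
  A-M F a = proj₂ (split-∧ (onX F ≡ᵇ t) (proj₂ (split-∧ (∣ F ∣ ≡ᵇ k) a)))
  B-X : ∀ F → T (partB F) → T (onX F ≡ᵇ t)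
  B-X F b = proj₁ (split-∧ (onX F ≡ᵇ t) (proj₁ (split-∧ (meetsMinX F) (proj₂ (split-∧ (∣ F ∣ ≡ᵇ k) b)))))
  B-M : ∀ F → T (partB F) → T (onM F ≡ᵇ t)
  B-M F b = proj₂ (split-∧ (onX F ≡ᵇ t) (proj₁ (split-∧ (meetsMinX F) (proj₂ (split-∧ (∣ F ∣ ≡ᵇ k) b)))))
  C-X : ∀ F → T (partC F) → T (onX F ≡ᵇ t₀)
  C-X F γ = proj₁ (split-∧ (onX F ≡ᵇ t₀) (proj₂ (split-∧ (onC F ≡ᵇ ∣ F ∣) (proj₂ (split-∧ (∣ F ∣ ≡ᵇ k) γ)))))

  -- Sets in 𝒜 meet M ∖ X, sets in ℬ do not; sets in 𝒞 miss a point of X, the others contain X.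
  A#BC : Disjoint partA (λ F → partB F ∨ partC F)
  A#BC = Disjoint-∨ (λ F a β → <ᵇ-≡ᵇ-excl t (onM F) (A-M F a) (B-M F β))
                    (λ F a γ → ≡ᵇ-suc-excl (onX F) t₀ (A-X F a) (C-X F γ))

  B#C : Disjoint partB partC
  B#C F β γ = ≡ᵇ-suc-excl (onX F) t₀ (B-X F β) (C-X F γ)

  -- |𝒜| = C(n−t, k−t) − C(n−k, k−t): the k-sets containing X, except those with F ∩ M = X.
  count-A : count n partA + ((e + q) C r) ≡ N C r
  count-A = begin
    count n partA + ((e + q) C r)   ≡⟨ cong (count n partA +_) (sym count-rest) ⟩
    count n partA + count n rest    ≡⟨ sym (count-∨ n partA rest A#rest) ⟩
    count n (λ F → partA F ∨ rest F) ≡⟨ sym (count-ext n whole-split) ⟩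
    count n whole                 ≡⟨ count-blocks₂ t N t r ⟩
    (t C t) * (N C r)             ≡⟨ trans (cong (_* (N C r)) (nCn≡1 t)) (*-identityˡ (N C r)) ⟩
    N C r                         ∎
    where
      whole rest : Subset n → Bool
      whole F = (∣ F ∣ ≡ᵇ k) ∧ (onX F ≡ᵇ t)
      rest F = (∣ F ∣ ≡ᵇ k) ∧ meetsMinX F
      A#rest : Disjoint partA rest
      A#rest F a ρ = <ᵇ-≡ᵇ-excl t (onM F) (A-M F a)
                       (proj₂ (split-∧ (onX F ≡ᵇ t) (proj₂ (split-∧ (∣ F ∣ ≡ᵇ k) ρ))))
      covers : ∀ F → (onX F ≡ᵇ t) ∧ ((t <ᵇ onM F) ∨ (onM F ≡ᵇ t)) ≡ (onX F ≡ᵇ t)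
      covers F rewrite seg-split t N r F =
        trans (≡ᵇ-guard (onX F) t (λ u → (t <ᵇ u + v) ∨ (u + v ≡ᵇ t)))
              (trans (cong ((onX F ≡ᵇ t) ∧_) (above-or-at t v)) (∧-identityʳ _))
        where v = ∣ drop t F ∩ seg N r ∣
      whole-split : ∀ F → whole F ≡ partA F ∨ rest F
      whole-split F = sym (begin
        partA F ∨ rest F
          ≡⟨ sym (∧-distribˡ-∨ (∣ F ∣ ≡ᵇ k) _ _) ⟩
        (∣ F ∣ ≡ᵇ k) ∧ (((onX F ≡ᵇ t) ∧ (t <ᵇ onM F)) ∨ meetsMinX F)
          ≡⟨ cong ((∣ F ∣ ≡ᵇ k) ∧_) (sym (∧-distribˡ-∨ (onX F ≡ᵇ t) _ _)) ⟩
        (∣ F ∣ ≡ᵇ k) ∧ ((onX F ≡ᵇ t) ∧ ((t <ᵇ onM F) ∨ (onM F ≡ᵇ t)))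
          ≡⟨ cong ((∣ F ∣ ≡ᵇ k) ∧_) (covers F) ⟩
        whole F ∎)
      count-rest : count n rest ≡ (e + q) C r
      count-rest = begin
        count n rest
          ≡⟨ count-ext n (λ F → cong (λ z → (∣ F ∣ ≡ᵇ k) ∧ ((onX F ≡ᵇ t) ∧ (onM F ≡ᵇ z))) (sym (+-identityʳ t))) ⟩
        _ ≡⟨ count-blocks₃ t r (e + q) t 0 r ⟩
        (t C t) * ((r C 0) * ((e + q) C r))
          ≡⟨ trans (cong (_* (1 * ((e + q) C r))) (nCn≡1 t)) (trans (*-identityˡ _) (*-identityˡ _)) ⟩
        (e + q) C r ∎

  -- |ℬ| = C(n−c, 2k−t−c): F contains X and C ∖ M, misses M ∖ X, and has r' points outside C.
  count-B : count n partB ≡ q C r'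
  count-B = begin
    count n partB ≡⟨ count-ext n as-blocks ⟩
    _             ≡⟨ count-blocks₄ t r e q t 0 e r' ⟩
    (t C t) * ((r C 0) * ((e C e) * (q C r')))
      ≡⟨ cong₂ (λ x y → x * (1 * (y * (q C r')))) (nCn≡1 t) (nCn≡1 e) ⟩
    1 * (1 * (1 * (q C r')))
      ≡⟨ trans (*-identityˡ _) (trans (*-identityˡ _) (*-identityˡ _)) ⟩
    q C r' ∎
    where
      as-blocks : ∀ F → partB F ≡ (∣ F ∣ ≡ᵇ k) ∧ ((onX F ≡ᵇ t) ∧ ((onM F ≡ᵇ t + 0) ∧ (onC F ≡ᵇ t + e)))
      as-blocks F = cong ((∣ F ∣ ≡ᵇ k) ∧_)
        (trans (∧-assoc (onX F ≡ᵇ t) (onM F ≡ᵇ t) (onC F ≡ᵇ t + e))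
               (cong (λ z → (onX F ≡ᵇ t) ∧ ((onM F ≡ᵇ z) ∧ (onC F ≡ᵇ t + e))) (sym (+-identityʳ t))))

  -- |𝒞| = t(c−k): F misses one of the t points of X, contains M ∖ X and one of the e points of C ∖ M.
  count-C : count n partC ≡ t * e
  count-C = begin
    count n partC ≡⟨ count-ext n as-blocks ⟩
    _             ≡⟨ count-blocks₄ t r e q t₀ r 1 0 ⟩
    (t C t₀) * ((r C r) * ((e C 1) * (q C 0)))
      ≡⟨ cong₂ (λ x y → x * (y * ((e C 1) * 1))) (C-sub1 t₀) (nCn≡1 r) ⟩
    t * (1 * ((e C 1) * 1))
      ≡⟨ cong (t *_) (trans (*-identityˡ _) (trans (*-identityʳ (e C 1)) (nC1≡n e))) ⟩
    t * e ∎
    where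
      k≡ : k ≡ t₀ + (r + 1)
      k≡ = sym (trans (cong (t₀ +_) (+-comm r 1)) (+-suc t₀ r))
      as-blocks : ∀ F → partC F ≡ (∣ F ∣ ≡ᵇ t₀ + (r + 1))
                                    ∧ ((onX F ≡ᵇ t₀) ∧ ((onM F ≡ᵇ t₀ + r) ∧ (onC F ≡ᵇ t₀ + (r + 1))))
      as-blocks F = begin
        partC F
          ≡⟨ ≡ᵇ-guard ∣ F ∣ k (λ z → (onC F ≡ᵇ z) ∧ inner) ⟩
        (∣ F ∣ ≡ᵇ k) ∧ ((onC F ≡ᵇ k) ∧ inner)
          ≡⟨ cong ((∣ F ∣ ≡ᵇ k) ∧_) (trans (∧-comm (onC F ≡ᵇ k) inner) (∧-assoc (onX F ≡ᵇ t₀) _ _)) ⟩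
        (∣ F ∣ ≡ᵇ k) ∧ ((onX F ≡ᵇ t₀) ∧ ((onM F ≡ᵇ t₀ + r) ∧ (onC F ≡ᵇ k)))
          ≡⟨ cong₂ (λ y z → (∣ F ∣ ≡ᵇ y) ∧ ((onX F ≡ᵇ t₀) ∧ ((onM F ≡ᵇ t₀ + r) ∧ (onC F ≡ᵇ z)))) k≡ k≡ ⟩
        _ ∎
        where inner = (onX F ≡ᵇ t₀) ∧ (onM F ≡ᵇ t₀ + r)

  h₁-closed : h₁ n t k c + ((e + q) C r) ≡ (N C r) + ((q C r') + t * e)
  h₁-closed = begin
    h₁ n t k c + ((e + q) C r)
      ≡⟨ cong (_+ ((e + q) C r)) (trans (countK≡count n k _ _) (count-ext n h₁-test)) ⟩
    count n (λ F → partA F ∨ (partB F ∨ partC F)) + ((e + q) C r)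
      ≡⟨ cong (_+ ((e + q) C r)) (trans (count-∨ n _ _ A#BC) (cong (count n partA +_) (count-∨ n _ _ B#C))) ⟩
    (count n partA + (count n partB + count n partC)) + ((e + q) C r)
      ≡⟨ move-last (count n partA) (count n partB) (count n partC) ((e + q) C r) ⟩
    (count n partA + ((e + q) C r)) + (count n partB + count n partC)
      ≡⟨ cong₂ _+_ count-A (cong₂ _+_ count-B count-C) ⟩
    (N C r) + ((q C r') + t * e) ∎
    where
      move-last : ∀ a b c d → (a + (b + c)) + d ≡ (a + d) + (b + c)
      move-last = solve-∀

-- The closed form |H₂(Z)| = (t+2) C(n−t−2, k−t−1) + C(n−t−2, k−t−2), for
-- |Z| = t+2, n = t+2+m and k = t+2+s: F meets Z in t+1 or in t+2 points.
h₂-closed : ∀ t m s → h₂ (suc (suc t) + m) t (suc (suc (t + s))) ≡ suc (suc t) * (m C suc s) + (m C s)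
h₂-closed t m s = begin
  h₂ n t k
    ≡⟨ trans (countK≡count n k _ _) (count-ext n two-cases) ⟩
  count n (λ F → missOne F ∨ allIn F)
    ≡⟨ count-∨ n missOne allIn missOne#allIn ⟩
  count n missOne + count n allIn
    ≡⟨ cong₂ _+_ (trans (count-ext n (λ F → cong (λ y → (∣ F ∣ ≡ᵇ y) ∧ (onZ F ≡ᵇ suc t)) k≡))
                        (count-blocks₂ z m (suc t) (suc s)))
                 (count-blocks₂ z m z s) ⟩
  (z C suc t) * (m C suc s) + (z C z) * (m C s)
    ≡⟨ cong₂ (λ x y → x * (m C suc s) + y * (m C s)) (C-sub1 (suc t)) (nCn≡1 z) ⟩
  z * (m C suc s) + 1 * (m C s)
    ≡⟨ cong (z * (m C suc s) +_) (*-identityˡ (m C s)) ⟩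
  z * (m C suc s) + (m C s) ∎
  where
    open ≡-Reasoning
    z = suc (suc t)
    n = z + m
    k = suc (suc (t + s))
    onZ : Subset n → ℕ
    onZ F = ∣ F ∩ seg n z ∣
    missOne allIn : Subset n → Bool
    missOne F = (∣ F ∣ ≡ᵇ k) ∧ (onZ F ≡ᵇ suc t)
    allIn F = (∣ F ∣ ≡ᵇ k) ∧ (onZ F ≡ᵇ z)
    two-cases : ∀ F → (∣ F ∣ ≡ᵇ k) ∧ (t <ᵇ onZ F) ≡ missOne F ∨ allIn F
    two-cases F = trans (cong ((∣ F ∣ ≡ᵇ k) ∧_) (above-t t (onZ F) (seg-bound n z F)))
                        (∧-distribˡ-∨ (∣ F ∣ ≡ᵇ k) _ _)
    missOne#allIn : Disjoint missOne allIn
    missOne#allIn F x y = ≡ᵇ-suc-excl (onZ F) (suc t) (proj₂ (split-∧ (∣ F ∣ ≡ᵇ k) y))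
                                                    (proj₂ (split-∧ (∣ F ∣ ≡ᵇ k) x))
    k≡ : k ≡ suc t + suc s
    k≡ = sym (cong suc (+-suc t s))

hockey : ℕ → ℕ → ℕ → ℕ
hockey j y zero    = 0
hockey j y (suc i) = (y C j) + hockey j (suc y) i

hockey-stick : ∀ j y i → (y + i) C suc j ≡ (y C suc j) + hockey j y i
hockey-stick j y zero    = trans (cong (_C suc j) (+-identityʳ y)) (sym (+-identityʳ _))
hockey-stick j y (suc i) = begin
  (y + suc i) C suc j                          ≡⟨ cong (_C suc j) (+-suc y i) ⟩
  (suc y + i) C suc j                          ≡⟨ hockey-stick j (suc y) i ⟩
  (suc y C suc j) + hockey j (suc y) i         ≡⟨ cong (_+ hockey j (suc y) i) (pascal y j) ⟩
  ((y C j) + (y C suc j)) + hockey j (suc y) i ≡⟨ swap (y C j) (y C suc j) (hockey j (suc y) i) ⟩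
  (y C suc j) + hockey j y (suc i)             ∎
  where
    open ≡-Reasoning
    swap : ∀ a b c → (a + b) + c ≡ b + (a + c)
    swap = solve-∀

C-step : ∀ x j → x C j ≤ suc x C j
C-step x zero    = ≤-refl
C-step x (suc j) = ≤-trans (m≤n+m (x C suc j) (x C j)) (≤-reflexive (sym (pascal x j)))

C-mono : ∀ x a j → x C j ≤ (x + a) C j
C-mono x zero    j = ≤-reflexive (cong (_C j) (sym (+-identityʳ x)))
C-mono x (suc a) j = ≤-trans (C-step x j) (≤-trans (C-mono (suc x) a j) (≤-reflexive (cong (_C j) (sym (+-suc x a)))))

-- Each of the i terms of the sum lies between the first and the last one.
hockey-upper : ∀ j y i → hockey j y (suc i) ≤ suc i * ((y + i) C j)
hockey-upper j y zero    = ≤-reflexive (cong (λ z → (z C j) + 0) (sym (+-identityʳ y)))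
hockey-upper j y (suc i) = begin
  (y C j) + hockey j (suc y) (suc i)
    ≤⟨ +-mono-≤ (C-mono y (suc i) j) (hockey-upper j (suc y) i) ⟩
  ((y + suc i) C j) + suc i * ((suc y + i) C j)
    ≡⟨ cong (λ z → ((y + suc i) C j) + suc i * (z C j)) (sym (+-suc y i)) ⟩
  suc (suc i) * ((y + suc i) C j) ∎
  where open ≤-Reasoning

hockey-lower : ∀ j y i → i * (y C j) ≤ hockey j y i
hockey-lower j y zero    = z≤n
hockey-lower j y (suc i) =
  +-monoʳ-≤ (y C j) (≤-trans (*-monoʳ-≤ i (C-step y j)) (hockey-lower j (suc y) i))

C-pos : ∀ x j → j ≤ x → 1 ≤ x C j
C-pos x       zero    _         = ≤-refl
C-pos (suc x) (suc j) (s≤s j≤x) = ≤-trans (C-pos x j j≤x) (≤-trans (m≤m+n (x C j) (x C suc j)) (≤-reflexive (sym (pascal x j))))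

C-two : ∀ x j → 1 ≤ j → j < x → 2 ≤ x C j
C-two (suc x) (suc j) _ (s≤s j<x) =
  ≤-trans (+-mono-≤ (C-pos x j (≤-trans (n≤1+n j) j<x)) (C-pos x (suc j) j<x)) (≤-reflexive (sym (pascal x j)))

absorption : ∀ x j → suc j * (suc x C suc j) ≡ suc x * (x C j)
absorption x       zero    = trans (*-identityˡ _) (trans (nC1≡n (suc x)) (sym (*-identityʳ (suc x))))
absorption zero    (suc j) = *-zeroʳ (suc (suc j))
absorption (suc x) (suc j) = begin
  suc (suc j) * (suc (suc x) C suc (suc j))
    ≡⟨ cong (suc (suc j) *_) (pascal (suc x) (suc j)) ⟩
  suc (suc j) * (P + (suc x C suc (suc j)))
    ≡⟨ *-distribˡ-+ (suc (suc j)) P _ ⟩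
  (P + suc j * P) + suc (suc j) * (suc x C suc (suc j))
    ≡⟨ cong₂ (λ a b → (P + a) + b) (absorption x j) (absorption x (suc j)) ⟩
  (P + suc x * (x C j)) + suc x * (x C suc j)
    ≡⟨ trans (+-assoc P _ _) (cong (P +_) (sym (*-distribˡ-+ (suc x) (x C j) _))) ⟩
  P + suc x * ((x C j) + (x C suc j))
    ≡⟨ cong (λ z → P + suc x * z) (sym (pascal x j)) ⟩
  suc (suc x) * P ∎
  where
    open ≡-Reasoning
    P = suc x C suc j

pascal² : ∀ m j → suc (suc m) C suc (suc j) ≡ ((m C j) + ((m C suc j) + (m C suc j))) + (m C suc (suc j))
pascal² m j = begin
  suc (suc m) C suc (suc j)
    ≡⟨ pascal (suc m) (suc j) ⟩
  (suc m C suc j) + (suc m C suc (suc j))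
    ≡⟨ cong₂ _+_ (pascal m j) (pascal m (suc j)) ⟩
  ((m C j) + (m C suc j)) + ((m C suc j) + (m C suc (suc j)))
    ≡⟨ regroup (m C j) (m C suc j) (m C suc (suc j)) ⟩
  ((m C j) + ((m C suc j) + (m C suc j))) + (m C suc (suc j)) ∎
  where
    open ≡-Reasoning
    regroup : ∀ a b c → (a + b) + (b + c) ≡ (a + (b + b)) + c
    regroup = solve-∀

h₁-reduce : ∀ s y h rest → h + (y C suc (suc s)) ≡ ((suc (suc s) + y) C suc (suc s)) + rest →
  h ≡ (((y + s) C s) + (((y + s) C suc s) + ((y + s) C suc s))) + (hockey (suc s) y s + rest)
h₁-reduce s y h rest eq = +-cancelʳ-≡ (y C suc (suc s)) h _ (begin
  h + (y C suc (suc s))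
    ≡⟨ eq ⟩
  ((suc (suc s) + y) C suc (suc s)) + rest
    ≡⟨ cong (λ z → (suc (suc z) C suc (suc s)) + rest) (+-comm s y) ⟩
  (suc (suc (y + s)) C suc (suc s)) + rest
    ≡⟨ cong (_+ rest) (pascal² (y + s) s) ⟩
  (YXX + ((y + s) C suc (suc s))) + rest
    ≡⟨ cong (λ z → (YXX + z) + rest) (hockey-stick (suc s) y s) ⟩
  (YXX + ((y C suc (suc s)) + hockey (suc s) y s)) + rest
    ≡⟨ regroup YXX (y C suc (suc s)) (hockey (suc s) y s) rest ⟩
  (YXX + (hockey (suc s) y s + rest)) + (y C suc (suc s)) ∎)
  where
    open ≡-Reasoning
    YXX = ((y + s) C s) + (((y + s) C suc s) + ((y + s) C suc s))
    regroup : ∀ a b c d → (a + (b + c)) + d ≡ (a + (c + d)) + b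
    regroup = solve-∀

-- Comparison of the two sides of h₁ ≤ h₂: both contain C(M,k−t−2) + 2C(M,k−t−1)
-- (M = n−t−2), so only a + δ ≤ tX remains, X = C(M,k−t−1).
add-common : ∀ t X Y a δ → a + δ ≤ t * X → ((Y + (X + X)) + a) + δ ≤ suc (suc t) * X + Y
add-common t X Y a δ a+δ≤tX = begin
  ((Y + (X + X)) + a) + δ ≡⟨ regroup Y X a δ ⟩
  (a + δ) + (X + X + Y)   ≤⟨ +-monoˡ-≤ (X + X + Y) a+δ≤tX ⟩
  t * X + (X + X + Y)     ≡⟨ expand t X Y ⟩
  suc (suc t) * X + Y     ∎
  where
    open ≤-Reasoning
    regroup : ∀ Y X a δ → ((Y + (X + X)) + a) + δ ≡ (a + δ) + (X + X + Y)
    regroup = solve-∀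
    expand : ∀ t X Y → t * X + (X + X + Y) ≡ suc (suc t) * X + Y
    expand = solve-∀

add-common-strict : ∀ t X Y a → t * X < a → suc (suc t) * X + Y < (Y + (X + X)) + a
add-common-strict t X Y a tX<a = begin-strict
  suc (suc t) * X + Y ≡⟨ expand t X Y ⟩
  t * X + (X + X + Y) <⟨ +-monoˡ-< (X + X + Y) tX<a ⟩
  a + (X + X + Y)     ≡⟨ regroup Y X a ⟩
  (Y + (X + X)) + a   ∎
  where
    open ≤-Reasoning
    expand : ∀ t X Y → suc (suc t) * X + Y ≡ t * X + (X + X + Y)
    expand = solve-∀
    regroup : ∀ Y X a → a + (X + X + Y) ≡ (Y + (X + X)) + a
    regroup = solve-∀

-- Part (ii), t = s+1+g ≥ s+1: with H = Σ_{l≤s} C(q+l, s+1),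
-- H + t + (s+g) ≤ t C(q+s+1, s+1).  Equality forces s = g = 0.
bound-ii : ∀ s g q → 1 ≤ q →
  hockey (suc s) q (suc s) + (suc s + g) + (s + g) ≤ (suc s + g) * ((suc q + s) C suc s)
bound-ii s g (suc q₁) _ = begin
  H + (suc s + g) + (s + g)          ≡⟨ regroup H s g ⟩
  H + ((suc s + s) + (g + g))        ≤⟨ +-mono-≤ H≤sE (+-mono-≤ sD-bound gX-bound) ⟩
  suc s * E + (suc s * D + g * (D + E)) ≡⟨ collect s g D E ⟩
  (suc s + g) * (D + E)              ≡⟨ cong ((suc s + g) *_) (sym (pascal (q + s) s)) ⟩
  (suc s + g) * ((suc q + s) C suc s) ∎
  where
    open ≤-Reasoning
    q = suc q₁
    H = hockey (suc s) q (suc s)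
    D = (q + s) C s
    E = (q + s) C suc s
    H≤sE : H ≤ suc s * E
    H≤sE = hockey-upper (suc s) q s
    -- D = C(q+s, s) ≥ C(s+1, s) = s+1.
    s<D : suc s ≤ D
    s<D = ≤-trans (≤-reflexive (sym (C-sub1 s)))
                  (≤-trans (C-mono (suc s) q₁ s) (≤-reflexive (cong (λ z → suc z C s) (+-comm s q₁))))
    sD-bound : suc s + s ≤ suc s * D
    sD-bound = ≤-trans (+-monoʳ-≤ (suc s) (m≤m*n s (suc s))) (*-monoʳ-≤ (suc s) s<D)
    2≤D+E : 2 ≤ D + E
    2≤D+E = +-mono-≤ (≤-trans (s≤s z≤n) s<D) (C-pos (q + s) (suc s) (s≤s (m≤n+m s q₁)))
    gX-bound : g + g ≤ g * (D + E)
    gX-bound = ≤-trans (≤-reflexive (double g)) (*-monoʳ-≤ g 2≤D+E)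
      where double : ∀ g → g + g ≡ g * 2
            double = solve-∀
    regroup : ∀ H s g → H + (suc s + g) + (s + g) ≡ H + ((suc s + s) + (g + g))
    regroup = solve-∀
    collect : ∀ s g D E → suc s * E + (suc s * D + g * (D + E)) ≡ (suc s + g) * (D + E)
    collect = solve-∀

-- Part (i), c = k+2, t = s = s₀+1 and q' = n−k−2 ≥ s₀:
-- Σ_{l<s} C(q'+2+l, s+1) + C(q', s) + 2s + s₀ ≤ s C(q'+s+2, s+1).
-- Equality forces s₀ = 0.
bound-k+2 : ∀ s₀ q' → s₀ ≤ q' →
  hockey (suc (suc s₀)) (suc (suc q')) (suc s₀) + ((q' C suc s₀) + suc s₀ * 2) + s₀
  ≤ suc s₀ * ((suc (suc q') + suc s₀) C suc (suc s₀))
bound-k+2 s₀ q' s₀≤q' = begin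
  H + (B + s * 2) + s₀   ≡⟨ +-assoc H (B + s * 2) s₀ ⟩
  H + ((B + s * 2) + s₀) ≤⟨ +-mono-≤ H≤sE sD-bound ⟩
  s * E + s * D          ≡⟨ trans (+-comm (s * E) (s * D)) (sym (*-distribˡ-+ s D E)) ⟩
  s * (D + E)            ≡⟨ cong (s *_) (sym X≡D+E) ⟩
  s * ((y + s) C suc s)  ∎
  where
    open ≤-Reasoning
    s = suc s₀
    y = suc (suc q')
    H = hockey (suc s) y s
    B = q' C s
    D = (y + s₀) C s
    E = (y + s₀) C suc s
    X≡D+E : (y + s) C suc s ≡ D + E
    X≡D+E = trans (cong (_C suc s) (+-suc y s₀)) (pascal (y + s₀) s)
    H≤sE : H ≤ s * E
    H≤sE = hockey-upper (suc s) y s₀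
    -- D = C(q'+s+1, s) = C(q', s) + Σ_{l≤s} C(q'+l, s−1) ≥ C(q', s) + s + 1.
    D-bound : B + suc s ≤ D
    D-bound = begin
      B + suc s                      ≤⟨ +-monoʳ-≤ B (≤-trans (≤-reflexive (sym (*-identityʳ (suc s))))
                                                             (*-monoʳ-≤ (suc s) (C-pos q' s₀ s₀≤q'))) ⟩
      B + suc s * (q' C s₀)          ≤⟨ +-monoʳ-≤ B (hockey-lower s₀ q' (suc s)) ⟩
      B + hockey s₀ q' (suc s)       ≡⟨ sym (hockey-stick s₀ q' (suc s)) ⟩
      (q' + suc s) C s               ≡⟨ cong (_C s) (shift q' s₀) ⟩
      D                              ∎
      where shift : ∀ q' s₀ → q' + suc (suc s₀) ≡ suc (suc q') + s₀
            shift = solve-∀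
    2≤D : 2 ≤ D
    2≤D = ≤-trans (s≤s (s≤s z≤n)) (≤-trans (m≤n+m (suc s) B) D-bound)
    sD-bound : (B + s * 2) + s₀ ≤ s * D
    sD-bound = begin
      (B + s * 2) + s₀       ≡⟨ regroup B s₀ ⟩
      (B + suc s) + s₀ * 2   ≤⟨ +-mono-≤ D-bound (*-monoʳ-≤ s₀ 2≤D) ⟩
      D + s₀ * D             ∎
      where regroup : ∀ B s₀ → (B + suc s₀ * 2) + s₀ ≡ (B + suc (suc s₀)) + s₀ * 2
            regroup = solve-∀

-- Part (i), c = k+1, t = s = 1 and q = n−k−1 ≥ 4: C(q+2, 2) < C(q,2) + C(q+1,2) + 1,
-- since C(q,2) > q.
strict-t=1 : ∀ d → let q = 4 + d in
  1 * ((suc q + 1) C 2) < hockey 2 q 2 + 1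
strict-t=1 d = begin-strict
  1 * ((suc q + 1) C 2)           ≡⟨ trans (*-identityˡ _) (cong (_C 2) (+-comm (suc q) 1)) ⟩
  suc (suc q) C 2                 ≡⟨ trans (pascal (suc q) 1) (cong (_+ (suc q C 2)) (nC1≡n (suc q))) ⟩
  suc q + (suc q C 2)             ≤⟨ +-monoˡ-≤ (suc q C 2) q<qC2 ⟩
  (q C 2) + (suc q C 2)           <⟨ m<m+n _ (s≤s z≤n) ⟩
  (q C 2) + (suc q C 2) + 1       ≡⟨ regroup (q C 2) (suc q C 2) ⟩
  hockey 2 q 2 + 1                ∎
  where
    open ≤-Reasoning
    q = 4 + d
    -- C(q,2) = (q−1) + C(q−1,2) ≥ (q−1) + 2.
    q<qC2 : q < q C 2
    q<qC2 = begin
      suc q                        ≡⟨ +-comm 2 (3 + d) ⟩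
      (3 + d) + 2                  ≤⟨ +-monoʳ-≤ (3 + d) (C-two (3 + d) 2 (s≤s z≤n) (s≤s (s≤s (s≤s z≤n)))) ⟩
      (3 + d) + ((3 + d) C 2)      ≡⟨ cong (_+ ((3 + d) C 2)) (sym (nC1≡n (3 + d))) ⟩
      ((3 + d) C 1) + ((3 + d) C 2) ≡⟨ sym (pascal (3 + d) 1) ⟩
      q C 2                        ∎
    regroup : ∀ a b → a + b + 1 ≡ a + (b + 0) + 1
    regroup = solve-∀

-- Part (i), c = k+1, t = s ≥ 1 and (s+1)³ ≤ q+s+1:
-- s C(q+s+1, s+1) < Σ_{l≤s} C(q+l, s+1) + s.  The first sum is at most
-- (s+1) C(q, s+1), because C(q+s+1,s+1) is at least (s+1)² C(q+s,s) when q is large.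
strict-large : ∀ s q → 1 ≤ s → suc s * (suc s * suc s) ≤ suc q + s →
  s * ((suc q + s) C suc s) < hockey (suc s) q (suc s) + s
strict-large s q 1≤s cube = begin-strict
  s * X    ≤⟨ sX≤s1P ⟩
  s1 * P   ≤⟨ hockey-lower (suc s) q (suc s) ⟩
  H        <⟨ m<m+n H 1≤s ⟩
  H + s    ∎
  where
    open ≤-Reasoning
    s1 = suc s
    H = hockey (suc s) q (suc s)
    X = (suc q + s) C suc s
    P = q C suc s
    Q = (q + s) C s
    -- X = C(q, s+1) + Σ_{l≤s} C(q+l, s) ≤ P + (s+1) Q.
    X≤P+s1Q : X ≤ P + s1 * Q
    X≤P+s1Q = begin
      X                          ≡⟨ cong (_C suc s) (sym (+-suc q s)) ⟩
      (q + suc s) C suc s        ≡⟨ hockey-stick s q (suc s) ⟩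
      P + hockey s q (suc s)     ≤⟨ +-monoʳ-≤ P (hockey-upper s q s) ⟩
      P + s1 * Q                 ∎
    -- (s+1) X = (q+s+1) Q ≥ (s+1)³ Q.
    s1²Q≤X : s1 * s1 * Q ≤ X
    s1²Q≤X = *-cancelˡ-≤ s1 (begin
      s1 * (s1 * s1 * Q)         ≡⟨ regroup s1 Q ⟩
      (s1 * (s1 * s1)) * Q       ≤⟨ *-monoˡ-≤ Q cube ⟩
      (suc q + s) * Q            ≡⟨ sym (absorption (q + s) s) ⟩
      s1 * X                     ∎)
      where regroup : ∀ a b → a * (a * a * b) ≡ (a * (a * a)) * b
            regroup = solve-∀
    sX≤s1P : s * X ≤ s1 * P
    sX≤s1P = +-cancelʳ-≤ X (s * X) (s1 * P) (begin
      s * X + X                  ≡⟨ +-comm (s * X) X ⟩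
      s1 * X                     ≤⟨ *-monoʳ-≤ s1 X≤P+s1Q ⟩
      s1 * (P + s1 * Q)          ≡⟨ expand s1 P Q ⟩
      s1 * P + s1 * s1 * Q       ≤⟨ +-monoʳ-≤ (s1 * P) s1²Q≤X ⟩
      s1 * P + X                 ∎)
      where expand : ∀ a p q → a * (p + a * q) ≡ a * p + a * a * q
            expand = solve-∀

h₁-cong : ∀ {n n' t k k' c c'} → n ≡ n' → k ≡ k' → c ≡ c' → h₁ n t k c ≡ h₁ n' t k' c'
h₁-cong refl refl refl = refl

no-slack : ∀ a b δ → a + δ ≤ b → b ≡ a → δ ≡ 0
no-slack a b δ a+δ≤b b≡a =
  n≤0⇒n≡0 (+-cancelˡ-≤ a δ 0 (subst (a + δ ≤_) (trans b≡a (sym (+-identityʳ a))) a+δ≤b))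

-- The parameters of the theorem: t = t₀+1, k = t+2+s and n = 2k+1+d.  Then
-- n−k = y = q'+2 and n−t−2 = y+s; the closed forms of h₂ and of h₁ for
-- c = k+1, k+2 share the terms Y = C(y+s, s) and X = C(y+s, s+1).
module AtParameters (t₀ s d : ℕ) where
  t k n q' y X Y : ℕ
  t = suc t₀
  k = t + 2 + s
  n = suc (2 * k) + d
  q' = t₀ + 2 + s + d
  y = suc (suc q')
  X = (y + s) C suc s
  Y = (y + s) C s

  h₂-value : h₂ n t k ≡ suc (suc t) * X + Y
  h₂-value = trans (cong₂ (λ n' k' → h₂ n' t k') (n≡ t₀ s d) (k≡ t₀ s)) (h₂-closed t (y + s) s)
    where
      n≡ : ∀ t₀ s d → suc (2 * (suc t₀ + 2 + s)) + d ≡ suc (suc (suc t₀)) + (suc (suc (t₀ + 2 + s + d)) + s)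
      n≡ = solve-∀
      k≡ : ∀ t₀ s → suc t₀ + 2 + s ≡ suc (suc (suc t₀ + s))
      k≡ = solve-∀

  h₁-at-k+1 : h₁ n t k (k + 1) ≡ (Y + (X + X)) + (hockey (suc s) (suc q') (suc s) + t)
  h₁-at-k+1 = begin
    h₁ n t k (k + 1)
      ≡⟨ h₁-cong (n≡ t₀ s d) (k≡ t₀ s) (c≡ t₀ s) ⟩
    h₁ (H₁-count.n t₀ 1 (suc s) (suc q')) t (H₁-count.k t₀ 1 (suc s) (suc q')) (H₁-count.c t₀ 1 (suc s) (suc q'))
      ≡⟨ h₁-reduce s y _ _ (H₁-count.h₁-closed t₀ 1 (suc s) (suc q')) ⟩
    (Y + (X + X)) + (hockey (suc s) y s + ((suc q' C suc s) + t * 1))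
      ≡⟨ cong ((Y + (X + X)) +_) (regroup (hockey (suc s) y s) (suc q' C suc s) t) ⟩
    (Y + (X + X)) + (hockey (suc s) (suc q') (suc s) + t) ∎
    where
      open ≡-Reasoning
      n≡ : ∀ t₀ s d → suc (2 * (suc t₀ + 2 + s)) + d ≡ suc t₀ + ((1 + suc s) + (1 + suc (t₀ + 2 + s + d)))
      n≡ = solve-∀
      k≡ : ∀ t₀ s → suc t₀ + 2 + s ≡ suc t₀ + (1 + suc s)
      k≡ = solve-∀
      c≡ : ∀ t₀ s → suc t₀ + 2 + s + 1 ≡ suc t₀ + ((1 + suc s) + 1)
      c≡ = solve-∀
      regroup : ∀ a b t → a + (b + t * 1) ≡ (b + a) + t
      regroup = solve-∀

  h₁-at-k+2 : h₁ n t k (k + 2) ≡ (Y + (X + X)) + (hockey (suc s) y s + ((q' C s) + t * 2))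
  h₁-at-k+2 = trans (h₁-cong (n≡ t₀ s d) (k≡ t₀ s) (c≡ t₀ s))
                    (h₁-reduce s y _ _ (H₁-count.h₁-closed t₀ 2 s q'))
    where
      n≡ : ∀ t₀ s d → suc (2 * (suc t₀ + 2 + s)) + d ≡ suc t₀ + ((2 + s) + (2 + (t₀ + 2 + s + d)))
      n≡ = solve-∀
      k≡ : ∀ t₀ s → suc t₀ + 2 + s ≡ suc t₀ + (2 + s)
      k≡ = solve-∀
      c≡ : ∀ t₀ s → suc t₀ + 2 + s + 2 ≡ suc t₀ + ((2 + s) + 2)
      c≡ = solve-∀

-- Part (ii), s ≤ t₀ (that is k ≤ 2t+1), written t₀ = s+g: h₁(k+1) + (s+g) ≤ h₂.
bound-at-k+1 : ∀ s g d → let open AtParameters (s + g) s d in h₁ n t k (k + 1) + (s + g) ≤ h₂ n t k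
bound-at-k+1 s g d = subst₂ (λ a b → a + (s + g) ≤ b) (sym h₁-at-k+1) (sym h₂-value)
  (add-common t X Y _ (s + g) (bound-ii s g (suc q') (s≤s z≤n)))
  where open AtParameters (s + g) s d

-- Part (i), s = t (that is k = 2t+2), c = k+2: h₁(k+2) + t₀ ≤ h₂.
bound-at-k+2 : ∀ t₀ d → let open AtParameters t₀ (suc t₀) d in h₁ n t k (k + 2) + t₀ ≤ h₂ n t k
bound-at-k+2 t₀ d = subst₂ (λ a b → a + t₀ ≤ b) (sym h₁-at-k+2) (sym h₂-value)
  (add-common t X Y _ t₀ (bound-k+2 t₀ q' t₀≤q'))
  where
    open AtParameters t₀ (suc t₀) d
    t₀≤q' : t₀ ≤ q'
    t₀≤q' = ≤-trans (m≤m+n t₀ 2) (≤-trans (m≤m+n (t₀ + 2) (suc t₀)) (m≤m+n (t₀ + 2 + suc t₀) d))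

exceeds-at-t=1 : ∀ t₀ d → suc t₀ ≡ 1 → let open AtParameters t₀ (suc t₀) d in h₂ n t k < h₁ n t k (k + 1)
exceeds-at-t=1 zero d refl = subst₂ _<_ (sym h₂-value) (sym h₁-at-k+1) (add-common-strict t X Y _ (strict-t=1 d))
  where open AtParameters 0 1 d

-- Part (i), s = t, c = k+1: h₂ < h₁(k+1) once n − 2k − 1 ≥ (t+1)³.
exceeds-for-large-n : ∀ t₀ d → suc (suc t₀) * (suc (suc t₀) * suc (suc t₀)) ≤ d →
  let open AtParameters t₀ (suc t₀) d in h₂ n t k < h₁ n t k (k + 1)
exceeds-for-large-n t₀ d cube≤d = subst₂ _<_ (sym h₂-value) (sym h₁-at-k+1)
  (add-common-strict t X Y _ (strict-large (suc t₀) (suc q') (s≤s z≤n) (≤-trans cube≤d d≤M)))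
  where
    open AtParameters t₀ (suc t₀) d
    d≤M : d ≤ y + suc t₀
    d≤M = ≤-trans (m≤n+m d (t₀ + 2 + suc t₀)) (≤-trans (n≤1+n q') (≤-trans (n≤1+n (suc q')) (m≤m+n y (suc t₀))))

beyond : ∀ (P : ℕ → Set) m → (∀ d → P (suc m + d)) → ∀ n → m < n → P n
beyond P m P-beyond n m<n with m≤n⇒∃[o]m+o≡n m<n
... | d , refl = P-beyond d

Claim-i : ℕ → ℕ → Set
Claim-i t₀ s =
  (∀ n → 2 * k < n →
    h₂ n t k ≥ h₁ n t k (k + 2)
    × (h₂ n t k ≡ h₁ n t k (k + 2) → t ≡ 1)
    × (t ≡ 1 → h₁ n t k (k + 1) > h₂ n t k))
  × (2 ≤ t → ∃ λ N → ∀ n → N ≤ n → 2 * k < n → h₁ n t k (k + 1) > h₂ n t k)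
  where
    t = suc t₀
    k = t + 2 + s

Claim-ii : ℕ → ℕ → Set
Claim-ii t₀ s =
  ∀ n → 2 * k < n →
    h₂ n t k ≥ h₁ n t k (k + 1)
    × (h₂ n t k ≡ h₁ n t k (k + 1) → t ≡ 1 × k ≡ 3)
  where
    t = suc t₀
    k = t + 2 + s

claim-i : ∀ t₀ → Claim-i t₀ (suc t₀)
claim-i t₀ = beyond _ (2 * k) at-each-n , λ _ → N , large-n
  where
    k = suc t₀ + 2 + suc t₀
    cube = suc (suc t₀) * (suc (suc t₀) * suc (suc t₀))
    N = suc (2 * k) + cube
    at-each-n : ∀ d → let n = suc (2 * k) + d in
      h₂ n (suc t₀) k ≥ h₁ n (suc t₀) k (k + 2)
      × (h₂ n (suc t₀) k ≡ h₁ n (suc t₀) k (k + 2) → suc t₀ ≡ 1)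
      × (suc t₀ ≡ 1 → h₁ n (suc t₀) k (k + 1) > h₂ n (suc t₀) k)
    at-each-n d = m+n≤o⇒m≤o _ (bound-at-k+2 t₀ d)
                , (λ eq → cong suc (no-slack _ _ t₀ (bound-at-k+2 t₀ d) eq))
                , exceeds-at-t=1 t₀ d
    large-n : ∀ n → N ≤ n → 2 * k < n → h₁ n (suc t₀) k (k + 1) > h₂ n (suc t₀) k
    large-n n N≤n 2k<n = beyond (λ n → N ≤ n → h₁ n (suc t₀) k (k + 1) > h₂ n (suc t₀) k) (2 * k)
      (λ d N≤n → exceeds-for-large-n t₀ d (+-cancelˡ-≤ (suc (2 * k)) cube d N≤n)) n 2k<n N≤n

claim-ii : ∀ s g → Claim-ii (s + g) s
claim-ii s g = beyond _ (2 * k) λ d →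
    m+n≤o⇒m≤o _ (bound-at-k+1 s g d)
  , λ eq → extremal (no-slack _ _ (s + g) (bound-at-k+1 s g d) eq)
  where
    k = suc (s + g) + 2 + s
    extremal : s + g ≡ 0 → suc (s + g) ≡ 1 × k ≡ 3
    extremal s+g≡0 = cong suc s+g≡0 , cong₂ (λ a b → suc a + 2 + b) s+g≡0 (m+n≡0⇒m≡0 s s+g≡0)

lemma2p10 : ∀ (t k : ℕ) → 1 ≤ t → t + 2 ≤ k →
    (k ≡ 2 * (t + 1) →
      (∀ n → 2 * k < n →
        h₂ n t k ≥ h₁ n t k (k + 2)
        × (h₂ n t k ≡ h₁ n t k (k + 2) → t ≡ 1)
        × (t ≡ 1 → h₁ n t k (k + 1) > h₂ n t k))
      × (2 ≤ t → ∃ λ N → ∀ n → N ≤ n → 2 * k < n → h₁ n t k (k + 1) > h₂ n t k))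
    × (k ≤ 2 * t + 1 →
      ∀ n → 2 * k < n →
        h₂ n t k ≥ h₁ n t k (k + 1)
        × (h₂ n t k ≡ h₁ n t k (k + 1) → t ≡ 1 × k ≡ 3))
lemma2p10 zero     k () _
lemma2p10 (suc t₀) k _  t+2≤k with m≤n⇒∃[o]m+o≡n t+2≤k
... | s , refl =
      (λ k≡2t+2 → subst (Claim-i t₀) (sym (s≡t k≡2t+2)) (claim-i t₀))
    , (λ k≤2t+1 → let g , s+g≡t₀ = m≤n⇒∃[o]m+o≡n (s≤t₀ k≤2t+1) in
                  subst (λ t₀ → Claim-ii t₀ s) s+g≡t₀ (claim-ii s g))
  where
    s≡t : suc t₀ + 2 + s ≡ 2 * (suc t₀ + 1) → s ≡ suc t₀
    s≡t eq = +-cancelˡ-≡ (suc t₀ + 2) s (suc t₀) (trans eq (double t₀))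
      where double : ∀ t₀ → 2 * (suc t₀ + 1) ≡ suc t₀ + 2 + suc t₀
            double = solve-∀
    s≤t₀ : suc t₀ + 2 + s ≤ 2 * suc t₀ + 1 → s ≤ t₀
    s≤t₀ le = +-cancelˡ-≤ (suc t₀ + 2) s t₀ (≤-trans le (≤-reflexive (double t₀)))
      where double : ∀ t₀ → 2 * suc t₀ + 1 ≡ suc t₀ + 2 + t₀
            double = solve-∀
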